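{- Let $P=(p_1,\dots,p_k)$ be a sequence of positive integers and let $M_1,\dots,M_t$ be pairwise disjoint blocks of consecutive positions in $[k]$ such that all positions within each $M_s$ carry the same value. Then an $\mathrm{ROS}(P)$ exists if and only if an $\mathrm{ROS}(P)$ exists which is similar with respect to each of $M_1,\dots,M_t$ (separately).
   Context: An $\mathrm{ROS}(P)$ is an assignment of a non-negative rational number $X(i,j,\ell)$ to every multiset $\{i,j,\ell\}$ of elements of $[k]$ (invariant under permuting $i,j,\ell$) such that $\sum_{\ell\in[k]}X(i,j,\ell)=p_ip_j$ for all $i,j\in[k]$, and $X(i,i,i)=p_i^2$ and $X(i,i,j)=0$ for all $i\neq j$. If the positions of a block $M=a-1+[m]=\{a,\dots,a+m-1\}$ all carry the same part, $X$ is similar with respect to $M$ if there exist non-negative values $X'(i,j,a)$, $X'(i,a,a)$ (for $i,j\notin M$) and $X'(a,a,a)$ such that for all distinct $\alpha,\beta,\gamma\in M$ and all $i,j\notin M$: $X(i,j,\alpha)=X'(i,j,a)$, $X(i,\alpha,\beta)=X'(i,a,a)$, and $X(\alpha,\beta,\gamma)=X'(a,a,a)$. -}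

module Defs where

open import Data.Nat as ℕ using (ℕ; zero; suc)
open import Data.Fin using (Fin; toℕ) renaming (zero to fz; suc to fs)
open import Data.Integer using (+_)
open import Data.Rational using (ℚ; _/_; 0ℚ; _≤_; _+_)
open import Data.Product using (Σ; _×_; ∃; ∃-syntax; _,_)
open import Relation.Binary.PropositionalEquality using (_≡_; _≢_)
open import Relation.Nullary using (¬_)

ℕtoℚ : ℕ → ℚ
ℕtoℚ n = + n / 1

sumFin : ∀ {k} → (Fin k → ℚ) → ℚ
sumFin {zero} f = 0ℚ
sumFin {suc k} f = f fz + sumFin (λ ℓ → f (fs ℓ))

-- An assignment X of a value to each multiset {i,j,ℓ} is modelled as a function
-- Fin k → Fin k → Fin k → ℚ invariant under all permutations of its arguments.
record IsROS {k : ℕ} (p : Fin k → ℕ) (X : Fin k → Fin k → Fin k → ℚ) : Set where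
  field
    symm₁₂  : ∀ i j ℓ → X i j ℓ ≡ X j i ℓ
    symm₂₃  : ∀ i j ℓ → X i j ℓ ≡ X i ℓ j
    nonneg  : ∀ i j ℓ → 0ℚ ≤ X i j ℓ
    rowSum  : ∀ i j → sumFin (λ ℓ → X i j ℓ) ≡ ℕtoℚ (p i ℕ.* p j)
    diag    : ∀ i → X i i i ≡ ℕtoℚ (p i ℕ.* p i)
    offDiag : ∀ i j → i ≢ j → X i i j ≡ 0ℚ

record Block (k : ℕ) : Set where
  constructor block
  field
    start  : ℕ
    len    : ℕ
    inside : start ℕ.+ len ℕ.≤ k

_∈B_ : ∀ {k} → Fin k → Block k → Set
x ∈B block a m _ = (a ℕ.≤ toℕ x) × (toℕ x ℕ.< a ℕ.+ m)

Constant : ∀ {k} → (Fin k → ℕ) → Block k → Set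
Constant p M = ∀ x y → x ∈B M → y ∈B M → p x ≡ p y

Disjoint : ∀ {k} → Block k → Block k → Set
Disjoint M N = ∀ x → x ∈B M → x ∈B N → Data.Empty.⊥
  where import Data.Empty

-- X is similar with respect to M: there are non-negative values
-- X'(i,j,a) (= X₁ i j), X'(i,a,a) (= X₂ i), X'(a,a,a) (= X₃) such that for all
-- distinct α,β,γ ∈ M and i,j ∉ M:
--   X(i,j,α) = X'(i,j,a), X(i,α,β) = X'(i,a,a), X(α,β,γ) = X'(a,a,a).
Similar : ∀ {k} → (Fin k → Fin k → Fin k → ℚ) → Block k → Set
Similar {k} X M =
  Σ (Fin k → Fin k → ℚ) λ X₁ → Σ (Fin k → ℚ) λ X₂ → Σ ℚ λ X₃ →
    (∀ i j → 0ℚ ≤ X₁ i j) × (∀ i → 0ℚ ≤ X₂ i) × (0ℚ ≤ X₃) ×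
    (∀ i j α → ¬ (i ∈B M) → ¬ (j ∈B M) → α ∈B M → X i j α ≡ X₁ i j) ×
    (∀ i α β → ¬ (i ∈B M) → α ∈B M → β ∈B M → α ≢ β → X i α β ≡ X₂ i) ×
    (∀ α β γ → α ∈B M → β ∈B M → γ ∈B M → α ≢ β → β ≢ γ → α ≢ γ →
       X α β γ ≡ X₃)

{-# OPTIONS --safe #-}
-- Let Stab P be the group of permutations σ of the positions with p ∘ σ = p. Replacing an
-- ROS(P) X by its average  Y (x, y, z) = (1 / |Stab P|) Σ_{σ ∈ Stab P} X (σ x) (σ y) (σ z)
-- gives again an ROS(P): every defining condition is either linear or a pointwise condition
-- preserved by each σ, and Σ_ℓ X (σ i) (σ j) (σ ℓ) = p_(σ i) p_(σ j) = p_i p_j because σ is a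
-- bijection preserving P. The average is invariant under Stab P, and the permutations moving
-- only positions of a constant block M act transitively on tuples of distinct positions of M,
-- so Y takes a single value on each of the three kinds of triples in the definition of
-- similarity.
module Submission where

open import Defs
open import Data.Nat as ℕ using (ℕ; zero; suc; _^_; NonZero)
open import Data.Fin using (Fin; toℕ; combine; funToFin; finToFun) renaming (zero to fz; suc to fs)
open import Data.Fin.Properties using (_≟_; all?; any?; finToFun-funToFin; funToFin-finToFin)
open import Data.Fin.Permutation
  using (Permutation′; permutation; id; flip; transpose; _∘ₚ_; _⟨$⟩ʳ_; _⟨$⟩ˡ_; inverseˡ; inverseʳ)
open import Data.Rational using (ℚ; 0ℚ; 1ℚ; _+_; _*_; _≤_; _÷_; 1/_; Positive; positive; nonNegative)
import Data.Rational.Properties as ℚ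
open import Data.Product using (_×_; ∃-syntax; _,_; proj₁; proj₂)
open import Data.Sum using (_⊎_; inj₁; inj₂)
open import Data.List using (_∷_; [])
open import Data.List.Relation.Unary.All using (All; []; _∷_)
open import Data.List.Relation.Unary.AllPairs using ([]; _∷_)
open import Data.List.Relation.Unary.Unique.Propositional using (Unique)
open import Data.List.Relation.Binary.Pointwise using (Pointwise; []; _∷_)
open import Algebra.Bundles using (CommutativeMonoid)
import Algebra.Properties.CommutativeSemigroup as CommutativeSemigroupProperties
import Algebra.Properties.CommutativeMonoid.Sum as CommutativeMonoidSum
open import Function using (_∘_; case_of_; _⇔_; mk⇔; Equivalence; Injection)
open import Function.Properties.Inverse using (↔⇒↣)
open import Relation.Binary.PropositionalEquality
open import Relation.Nullary using (¬_; contradiction; Dec; yes; no; _×-dec_; _→-dec_)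
open import Relation.Nullary.Decidable using (¬?; dec-true; dec-false)

open CommutativeSemigroupProperties (CommutativeMonoid.commutativeSemigroup ℚ.+-0-commutativeMonoid)
  using (interchange)
private module Sum = CommutativeMonoidSum ℚ.+-0-commutativeMonoid

private variable
  m n : ℕ

sumFin-cong : {f g : Fin n → ℚ} → f ≗ g → sumFin f ≡ sumFin g
sumFin-cong {zero}  f≗g = refl
sumFin-cong {suc n} f≗g = cong₂ _+_ (f≗g fz) (sumFin-cong (f≗g ∘ fs))

sumFin-zero : ∀ n → sumFin {n} (λ _ → 0ℚ) ≡ 0ℚ
sumFin-zero zero    = refl
sumFin-zero (suc n) = cong (0ℚ +_) (sumFin-zero n)

sumFin-+ : (f g : Fin n → ℚ) → sumFin (λ x → f x + g x) ≡ sumFin f + sumFin g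
sumFin-+ {zero}  f g = refl
sumFin-+ {suc n} f g = trans (cong (f fz + g fz +_) (sumFin-+ (f ∘ fs) (g ∘ fs)))
  (interchange (f fz) (g fz) (sumFin (f ∘ fs)) (sumFin (g ∘ fs)))

*-distribˡ-sumFin : ∀ c (f : Fin n → ℚ) → sumFin (λ x → c * f x) ≡ c * sumFin f
*-distribˡ-sumFin {zero}  c f = sym (ℚ.*-zeroʳ c)
*-distribˡ-sumFin {suc n} c f = trans (cong (c * f fz +_) (*-distribˡ-sumFin c (f ∘ fs)))
  (sym (ℚ.*-distribˡ-+ c (f fz) (sumFin (f ∘ fs))))

*-distribʳ-sumFin : ∀ c (f : Fin n → ℚ) → sumFin (λ x → f x * c) ≡ sumFin f * c
*-distribʳ-sumFin {zero}  c f = sym (ℚ.*-zeroˡ c)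
*-distribʳ-sumFin {suc n} c f = trans (cong (f fz * c +_) (*-distribʳ-sumFin c (f ∘ fs)))
  (sym (ℚ.*-distribʳ-+ c (f fz) (sumFin (f ∘ fs))))

sumFin-swap : (f : Fin m → Fin n → ℚ) →
  sumFin (λ a → sumFin (f a)) ≡ sumFin (λ b → sumFin (λ a → f a b))
sumFin-swap {zero}  {n} f = sym (sumFin-zero n)
sumFin-swap {suc m}     f = trans (cong (sumFin (f fz) +_) (sumFin-swap (f ∘ fs)))
  (sym (sumFin-+ (f fz) (λ b → sumFin (λ a → f (fs a) b))))

sumFin-nonneg : {f : Fin n → ℚ} → (∀ x → 0ℚ ≤ f x) → 0ℚ ≤ sumFin f
sumFin-nonneg {zero}  f≥0 = ℚ.≤-refl
sumFin-nonneg {suc n} f≥0 = ℚ.+-mono-≤ (f≥0 fz) (sumFin-nonneg (f≥0 ∘ fs))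

≤-sumFin : {f : Fin n → ℚ} → (∀ x → 0ℚ ≤ f x) → ∀ x → f x ≤ sumFin f
≤-sumFin {f = f} f≥0 fz = subst (_≤ sumFin f) (ℚ.+-identityʳ (f fz))
  (ℚ.+-monoʳ-≤ (f fz) (sumFin-nonneg (f≥0 ∘ fs)))
≤-sumFin {f = f} f≥0 (fs x) = ℚ.≤-trans (≤-sumFin (f≥0 ∘ fs) x)
  (subst (_≤ sumFin f) (ℚ.+-identityˡ (sumFin (f ∘ fs))) (ℚ.+-monoˡ-≤ (sumFin (f ∘ fs)) (f≥0 fz)))

private
  sumFin≡sum : (f : Fin n → ℚ) → sumFin f ≡ Sum.sum f
  sumFin≡sum {zero}  f = refl
  sumFin≡sum {suc n} f = cong (f fz +_) (sumFin≡sum (f ∘ fs))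

sumFin-permute : (π : Permutation′ n) (f : Fin n → ℚ) → sumFin f ≡ sumFin (f ∘ (π ⟨$⟩ʳ_))
sumFin-permute π f = begin
  sumFin f                 ≡⟨ sumFin≡sum f ⟩
  Sum.sum f                ≡⟨ Sum.sum-permute f π ⟩
  Sum.sum (f ∘ (π ⟨$⟩ʳ_))  ≡⟨ sumFin≡sum (f ∘ (π ⟨$⟩ʳ_)) ⟨
  sumFin (f ∘ (π ⟨$⟩ʳ_))   ∎
  where open ≡-Reasoning

funToFin-cong : {f g : Fin m → Fin n} → f ≗ g → funToFin f ≡ funToFin g
funToFin-cong {zero}  f≗g = refl
funToFin-cong {suc m} f≗g = cong₂ combine (f≗g fz) (funToFin-cong (f≗g ∘ fs))

Extensional : ((Fin m → Fin n) → ℚ) → Set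
Extensional H = ∀ {f g} → f ≗ g → H f ≡ H g

sumFun : ((Fin m → Fin n) → ℚ) → ℚ
sumFun H = sumFin (λ c → H (finToFun c))

precompose : Permutation′ m → Permutation′ (n ^ m)
precompose {m} {n} σ =
  permutation (along σʳ) (along σˡ) (cancel σʳ σˡ (inverseˡ σ)) (cancel σˡ σʳ (inverseʳ σ))
  where
  σʳ = σ ⟨$⟩ʳ_
  σˡ = σ ⟨$⟩ˡ_
  along : (Fin m → Fin m) → Fin (n ^ m) → Fin (n ^ m)
  along τ c = funToFin (finToFun c ∘ τ)
  cancel : ∀ τ τ′ → (∀ {x} → τ′ (τ x) ≡ x) → ∀ c → along τ (along τ′ c) ≡ c
  cancel τ τ′ τ′τ≡id c = trans
    (funToFin-cong (λ x → trans (finToFun-funToFin (finToFun c ∘ τ′) (τ x)) (cong (finToFun c) τ′τ≡id)))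
    (funToFin-finToFin {m} {n} c)

sumFun-∘ : (σ : Permutation′ m) {H : (Fin m → Fin n) → ℚ} → Extensional H →
  sumFun (λ f → H (f ∘ (σ ⟨$⟩ʳ_))) ≡ sumFun H
sumFun-∘ σ {H} H-ext = sym (trans (sumFin-permute (precompose σ) (H ∘ finToFun))
  (sumFin-cong (λ c → H-ext (finToFun-funToFin (finToFun c ∘ (σ ⟨$⟩ʳ_))))))

≤-sumFun : {H : (Fin m → Fin n) → ℚ} → Extensional H → (∀ f → 0ℚ ≤ H f) → ∀ f → H f ≤ sumFun H
≤-sumFun {H = H} H-ext H≥0 f =
  subst (_≤ sumFun H) (H-ext (finToFun-funToFin f)) (≤-sumFin (H≥0 ∘ finToFun) (funToFin f))

*-nonneg : ∀ {a b} → 0ℚ ≤ a → 0ℚ ≤ b → 0ℚ ≤ a * b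
*-nonneg {a} {b} a≥0 b≥0 = ℚ.nonNegative⁻¹ (a * b)
  {{ℚ.nonNeg*nonNeg⇒nonNeg a {{nonNegative a≥0}} b {{nonNegative b≥0}}}}

indicator : {A : Set} → Dec A → ℚ
indicator (yes _) = 1ℚ
indicator (no _)  = 0ℚ

indicator-nonneg : {A : Set} (d : Dec A) → 0ℚ ≤ indicator d
indicator-nonneg (yes _) = ℚ.nonNegative⁻¹ 1ℚ
indicator-nonneg (no _)  = ℚ.≤-refl

indicator-yes : {A : Set} (d : Dec A) → A → indicator d ≡ 1ℚ
indicator-yes (yes _) _ = refl
indicator-yes (no ¬a) a = contradiction a ¬a

indicator-cong : {A B : Set} → A ⇔ B → (d : Dec A) (d′ : Dec B) → indicator d ≡ indicator d′
indicator-cong A⇔B (yes _) (yes _) = refl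
indicator-cong A⇔B (yes a) (no ¬b) = contradiction (Equivalence.to A⇔B a) ¬b
indicator-cong A⇔B (no ¬a) (yes b) = contradiction (Equivalence.from A⇔B b) ¬a
indicator-cong A⇔B (no _)  (no _)  = refl

indicator-*-cong : {A : Set} (d : Dec A) {x y : ℚ} → (A → x ≡ y) → indicator d * x ≡ indicator d * y
indicator-*-cong (yes a)         x≡y = cong (1ℚ *_) (x≡y a)
indicator-*-cong (no _) {x} {y} x≡y = trans (ℚ.*-zeroˡ x) (sym (ℚ.*-zeroˡ y))

PreservesParts : (Fin n → ℕ) → (Fin n → Fin n) → Set
PreservesParts p f = ∀ x → p (f x) ≡ p x

InStabiliser : (Fin n → ℕ) → (Fin n → Fin n) → Set
InStabiliser p f = (∀ x y → f x ≡ f y → x ≡ y) × (∀ y → ∃[ x ] f x ≡ y) × PreservesParts p f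

module Stabiliser {k} (p : Fin k → ℕ) where

  inStabiliser? : ∀ f → Dec (InStabiliser p f)
  inStabiliser? f = all? (λ x → all? λ y → (f x ≟ f y) →-dec (x ≟ y))
              ×-dec all? (λ y → any? λ x → f x ≟ y)
              ×-dec all? (λ x → p (f x) ℕ.≟ p x)

  inStabiliser-resp-≗ : ∀ {f g} → f ≗ g → InStabiliser p f → InStabiliser p g
  inStabiliser-resp-≗ {f} {g} f≗g (inj , surj , pres) =
    (λ x y gx≡gy → inj x y (trans (f≗g x) (trans gx≡gy (sym (f≗g y))))) ,
    (λ y → let (x , fx≡y) = surj y in x , trans (sym (f≗g x)) fx≡y) ,
    (λ x → trans (cong p (sym (f≗g x))) (pres x))

  id-inStabiliser : InStabiliser p (λ x → x)
  id-inStabiliser = (λ _ _ x≡y → x≡y) , (λ y → y , refl) , (λ _ → refl)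

  inStabiliser-∘ : ∀ {f g} → InStabiliser p f → InStabiliser p g → InStabiliser p (f ∘ g)
  inStabiliser-∘ {f} {g} (f-inj , f-surj , f-pres) (g-inj , g-surj , g-pres) =
    (λ x y fgx≡fgy → g-inj x y (f-inj (g x) (g y) fgx≡fgy)) ,
    (λ z → let (y , fy≡z) = f-surj z ; (x , gx≡y) = g-surj y in x , trans (cong f gx≡y) fy≡z) ,
    (λ x → trans (f-pres (g x)) (g-pres x))

  permutation-inStabiliser : (σ : Permutation′ k) → PreservesParts p (σ ⟨$⟩ʳ_) → InStabiliser p (σ ⟨$⟩ʳ_)
  permutation-inStabiliser σ pres =
    (λ x y → Injection.injective (↔⇒↣ σ)) , (λ y → σ ⟨$⟩ˡ y , inverseʳ σ) , pres

  permutation⁻¹-preservesParts : (σ : Permutation′ k) → PreservesParts p (σ ⟨$⟩ʳ_) → PreservesParts p (σ ⟨$⟩ˡ_)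
  permutation⁻¹-preservesParts σ pres x = trans (sym (pres (σ ⟨$⟩ˡ x))) (cong p (inverseʳ σ))

  inStabiliser-∘-permutation : (σ : Permutation′ k) → PreservesParts p (σ ⟨$⟩ʳ_) →
    ∀ f → InStabiliser p (f ∘ (σ ⟨$⟩ʳ_)) ⇔ InStabiliser p f
  inStabiliser-∘-permutation σ pres f = mk⇔
    (λ fσ∈ → inStabiliser-resp-≗ (λ x → cong f (inverseʳ σ))
      (inStabiliser-∘ fσ∈ (permutation-inStabiliser (flip σ) (permutation⁻¹-preservesParts σ pres))))
    (λ f∈ → inStabiliser-∘ f∈ (permutation-inStabiliser σ pres))

  toPermutation : ∀ {f} → InStabiliser p f → Permutation′ k
  toPermutation {f} (inj , surj , _) =
    permutation f (proj₁ ∘ surj) (proj₂ ∘ surj) (λ x → inj _ x (proj₂ (surj (f x))))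

  weight : (Fin k → Fin k) → ℚ
  weight f = indicator (inStabiliser? f)

  weight-resp-≗ : Extensional weight
  weight-resp-≗ {f} {g} f≗g = indicator-cong
    (mk⇔ (inStabiliser-resp-≗ f≗g) (inStabiliser-resp-≗ (sym ∘ f≗g))) (inStabiliser? f) (inStabiliser? g)

  sumStab : ((Fin k → Fin k) → ℚ) → ℚ
  sumStab H = sumFun (λ f → weight f * H f)

  order : ℚ
  order = sumFun weight

  1≤order : 1ℚ ≤ order
  1≤order = subst (_≤ order) (indicator-yes (inStabiliser? (λ x → x)) id-inStabiliser)
    (≤-sumFun weight-resp-≗ (indicator-nonneg ∘ inStabiliser?) (λ x → x))

  sumStab-cong : ∀ {H G} → (∀ f → InStabiliser p f → H f ≡ G f) → sumStab H ≡ sumStab G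
  sumStab-cong H≡G = sumFin-cong (λ c → indicator-*-cong (inStabiliser? (finToFun c)) (H≡G (finToFun c)))

  sumStab-const : ∀ v → sumStab (λ _ → v) ≡ order * v
  sumStab-const v = *-distribʳ-sumFin v (weight ∘ finToFun)

  sumStab-nonneg : ∀ {H} → (∀ f → 0ℚ ≤ H f) → 0ℚ ≤ sumStab H
  sumStab-nonneg H≥0 = sumFin-nonneg (λ c →
    *-nonneg (indicator-nonneg (inStabiliser? (finToFun c))) (H≥0 (finToFun c)))

  sumStab-sumFin : ∀ {n} (H : (Fin k → Fin k) → Fin n → ℚ) →
    sumStab (λ f → sumFin (H f)) ≡ sumFin (λ ℓ → sumStab (λ f → H f ℓ))
  sumStab-sumFin H = trans (sumFin-cong (λ c → sym (*-distribˡ-sumFin (weight (finToFun c)) (H (finToFun c)))))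
    (sumFin-swap (λ c ℓ → weight (finToFun c) * H (finToFun c) ℓ))

  sumStab-∘ : (σ : Permutation′ k) → PreservesParts p (σ ⟨$⟩ʳ_) → ∀ {H} → Extensional H →
    sumStab (λ f → H (f ∘ (σ ⟨$⟩ʳ_))) ≡ sumStab H
  sumStab-∘ σ pres {H} H-ext = trans
    (sumFin-cong (λ c → cong (_* H (finToFun c ∘ (σ ⟨$⟩ʳ_))) (sym (indicator-cong
      (inStabiliser-∘-permutation σ pres (finToFun c))
      (inStabiliser? (finToFun c ∘ (σ ⟨$⟩ʳ_))) (inStabiliser? (finToFun c))))))
    (sumFun-∘ σ (λ f≗g → cong₂ _*_ (weight-resp-≗ f≗g) (H-ext f≗g)))

  instance
    order-positive : Positive order
    order-positive = positive (ℚ.<-≤-trans (ℚ.positive⁻¹ 1ℚ) 1≤order)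

    order-nonZero : Data.Rational.NonZero order
    order-nonZero = ℚ.pos⇒nonZero order

  average : ((Fin k → Fin k) → ℚ) → ℚ
  average H = sumStab H ÷ order

  average-cong : ∀ {H G} → (∀ f → InStabiliser p f → H f ≡ G f) → average H ≡ average G
  average-cong H≡G = cong (_÷ order) (sumStab-cong H≡G)

  average-const : ∀ {H} v → (∀ f → InStabiliser p f → H f ≡ v) → average H ≡ v
  average-const {H} v H≡v = begin
    average H               ≡⟨ cong (_* 1/ order) (trans (sumStab-cong H≡v) (sumStab-const v)) ⟩
    (order * v) * 1/ order  ≡⟨ cong (_* 1/ order) (ℚ.*-comm order v) ⟩
    (v * order) * 1/ order  ≡⟨ ℚ.*-assoc v order (1/ order) ⟩
    v * (order * 1/ order)  ≡⟨ cong (v *_) (ℚ.*-inverseʳ order) ⟩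
    v * 1ℚ                  ≡⟨ ℚ.*-identityʳ v ⟩
    v                       ∎
    where open ≡-Reasoning

  average-nonneg : ∀ {H} → (∀ f → 0ℚ ≤ H f) → 0ℚ ≤ average H
  average-nonneg H≥0 = *-nonneg (sumStab-nonneg H≥0)
    (ℚ.nonNegative⁻¹ (1/ order) {{ℚ.pos⇒nonNeg (1/ order) {{ℚ.1/pos⇒pos order}}}})

  average-sumFin : ∀ {n} (H : (Fin k → Fin k) → Fin n → ℚ) →
    average (λ f → sumFin (H f)) ≡ sumFin (λ ℓ → average (λ f → H f ℓ))
  average-sumFin H = trans (cong (_÷ order) (sumStab-sumFin H))
    (sym (*-distribʳ-sumFin (1/ order) (λ ℓ → sumStab (λ f → H f ℓ))))

  average-∘ : (σ : Permutation′ k) → PreservesParts p (σ ⟨$⟩ʳ_) → ∀ {H} → Extensional H →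
    average (λ f → H (f ∘ (σ ⟨$⟩ʳ_))) ≡ average H
  average-∘ σ pres H-ext = cong (_÷ order) (sumStab-∘ σ pres H-ext)

  symmetrise : (Fin k → Fin k → Fin k → ℚ) → Fin k → Fin k → Fin k → ℚ
  symmetrise X x y z = average (λ f → X (f x) (f y) (f z))

  symmetrise-isROS : ∀ {X} → IsROS p X → IsROS p (symmetrise X)
  symmetrise-isROS {X} ros = record
    { symm₁₂  = λ i j ℓ → average-cong (λ f _ → symm₁₂ (f i) (f j) (f ℓ))
    ; symm₂₃  = λ i j ℓ → average-cong (λ f _ → symm₂₃ (f i) (f j) (f ℓ))
    ; nonneg  = λ i j ℓ → average-nonneg (λ f → nonneg (f i) (f j) (f ℓ))
    ; rowSum  = λ i j → trans (sym (average-sumFin (λ f ℓ → X (f i) (f j) (f ℓ)))) (average-const _ (row i j))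
    ; diag    = λ i → average-const _ (λ f (_ , _ , pres) →
                  trans (diag (f i)) (cong (λ q → ℕtoℚ (q ℕ.* q)) (pres i)))
    ; offDiag = λ i j i≢j → average-const 0ℚ (λ f (inj , _) → offDiag (f i) (f j) (i≢j ∘ inj i j))
    }
    where
    open IsROS ros
    row : ∀ i j f → InStabiliser p f → sumFin (λ ℓ → X (f i) (f j) (f ℓ)) ≡ ℕtoℚ (p i ℕ.* p j)
    row i j f f∈@(_ , _ , pres) = begin
      sumFin (λ ℓ → X (f i) (f j) (f ℓ))  ≡⟨ sumFin-permute (toPermutation f∈) (X (f i) (f j)) ⟨
      sumFin (X (f i) (f j))              ≡⟨ rowSum (f i) (f j) ⟩
      ℕtoℚ (p (f i) ℕ.* p (f j))          ≡⟨ cong₂ (λ a b → ℕtoℚ (a ℕ.* b)) (pres i) (pres j) ⟩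
      ℕtoℚ (p i ℕ.* p j)                  ∎
      where open ≡-Reasoning

  symmetrise-invariant : (σ : Permutation′ k) → PreservesParts p (σ ⟨$⟩ʳ_) → ∀ X x y z →
    symmetrise X (σ ⟨$⟩ʳ x) (σ ⟨$⟩ʳ y) (σ ⟨$⟩ʳ z) ≡ symmetrise X x y z
  symmetrise-invariant σ pres X x y z = average-∘ σ pres
    (λ {f} {g} f≗g → trans (cong₂ (λ a b → X a b (f z)) (f≗g x) (f≗g y)) (cong (X (g x) (g y)) (f≗g z)))

transpose-matchˡ : (c d : Fin n) → transpose c d ⟨$⟩ʳ c ≡ d
transpose-matchˡ c d rewrite dec-true (c ≟ c) refl = refl

transpose-matchʳ : (c d : Fin n) → transpose c d ⟨$⟩ʳ d ≡ c
transpose-matchʳ c d with d ≟ c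
... | yes refl = refl
... | no _ rewrite dec-true (d ≟ d) refl = refl

transpose-other : {c d x : Fin n} → x ≢ c → x ≢ d → transpose c d ⟨$⟩ʳ x ≡ x
transpose-other {c = c} {d} {x} x≢c x≢d rewrite dec-false (x ≟ c) x≢c | dec-false (x ≟ d) x≢d = refl

SupportedIn : (Fin n → Set) → Permutation′ n → Set
SupportedIn M σ = ∀ x → σ ⟨$⟩ʳ x ≡ x ⊎ (M x × M (σ ⟨$⟩ʳ x))

module _ {M : Fin n → Set} where

  supportedIn-fixes : ∀ {σ x} → SupportedIn M σ → ¬ M x → σ ⟨$⟩ʳ x ≡ x
  supportedIn-fixes {x = x} supp ¬Mx with supp x
  ... | inj₁ σx≡x     = σx≡x
  ... | inj₂ (Mx , _) = contradiction Mx ¬Mx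

  supportedIn-∈ : ∀ {σ x} → SupportedIn M σ → M x → M (σ ⟨$⟩ʳ x)
  supportedIn-∈ {x = x} supp Mx with supp x
  ... | inj₁ σx≡x      = subst M (sym σx≡x) Mx
  ... | inj₂ (_ , Mσx) = Mσx

  supportedIn-preservesParts : ∀ {p σ} → (∀ x y → M x → M y → p x ≡ p y) →
    SupportedIn M σ → PreservesParts p (σ ⟨$⟩ʳ_)
  supportedIn-preservesParts {p} p-const supp x with supp x
  ... | inj₁ σx≡x       = cong p σx≡x
  ... | inj₂ (Mx , Mσx) = p-const _ x Mσx Mx

  supportedIn-∘ₚ : ∀ {σ τ} → SupportedIn M σ → SupportedIn M τ → SupportedIn M (σ ∘ₚ τ)
  supportedIn-∘ₚ {σ} {τ} σ-supp τ-supp x with σ-supp x | τ-supp (σ ⟨$⟩ʳ x)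
  ... | inj₁ σx≡x       | inj₁ τσx≡σx       = inj₁ (trans τσx≡σx σx≡x)
  ... | inj₁ σx≡x       | inj₂ (Mσx , Mτσx) = inj₂ (subst M σx≡x Mσx , Mτσx)
  ... | inj₂ (Mx , Mσx) | _                 = inj₂ (Mx , supportedIn-∈ {τ} τ-supp Mσx)

  supportedIn-transpose : ∀ {c d} → M c → M d → SupportedIn M (transpose c d)
  supportedIn-transpose {c} {d} Mc Md x = cases x (x ≟ c) (x ≟ d)
    where
    cases : ∀ x → Dec (x ≡ c) → Dec (x ≡ d) → transpose c d ⟨$⟩ʳ x ≡ x ⊎ (M x × M (transpose c d ⟨$⟩ʳ x))
    cases _ (yes refl) _          = inj₂ (Mc , subst M (sym (transpose-matchˡ c d)) Md)
    cases _ (no _)     (yes refl) = inj₂ (Md , subst M (sym (transpose-matchʳ c d)) Mc)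
    cases _ (no x≢c)   (no x≢d)   = inj₁ (transpose-other x≢c x≢d)

  -- Induction on the length: if σ already sends us to vs, composing with the transposition of
  -- σ a and b sends a to b and leaves the images vs alone.
  supportedIn-transitive : ∀ {us vs} → Pointwise (λ u v → M u × M v) us vs → Unique us → Unique vs →
    ∃[ σ ] SupportedIn M σ × Pointwise (λ u v → σ ⟨$⟩ʳ u ≡ v) us vs
  supportedIn-transitive [] [] [] = id , (λ _ → inj₁ refl) , []
  supportedIn-transitive {a ∷ _} {b ∷ _} ((Ma , Mb) ∷ Muvs) (a∉us ∷ us!) (b∉vs ∷ vs!)
    with supportedIn-transitive Muvs us! vs!
  ... | σ , σ-supp , σus≡vs =
    σ ∘ₚ τ ,
    supportedIn-∘ₚ {σ} {τ} σ-supp (supportedIn-transpose (supportedIn-∈ {σ} σ-supp Ma) Mb) ,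
    transpose-matchˡ (σ ⟨$⟩ʳ a) b ∷ τ-fixes σus≡vs a∉us b∉vs
    where
    τ = transpose (σ ⟨$⟩ʳ a) b
    σ-injective = Injection.injective (↔⇒↣ σ)
    τ-fixes : ∀ {us vs} → Pointwise (λ u v → σ ⟨$⟩ʳ u ≡ v) us vs → All (a ≢_) us → All (b ≢_) vs →
      Pointwise (λ u v → τ ⟨$⟩ʳ (σ ⟨$⟩ʳ u) ≡ v) us vs
    τ-fixes [] [] [] = []
    τ-fixes (σu≡v ∷ σus≡vs) (a≢u ∷ a∉us) (b≢v ∷ b∉vs) =
      trans (cong (τ ⟨$⟩ʳ_) σu≡v)
        (transpose-other (λ v≡σa → a≢u (sym (σ-injective (trans σu≡v v≡σa)))) (b≢v ∘ sym))
      ∷ τ-fixes σus≡vs a∉us b∉vs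

_∈B?_ : (x : Fin n) (M : Block n) → Dec (x ∈B M)
x ∈B? block a m _ = (a ℕ.≤? toℕ x) ×-dec (toℕ x ℕ.<? a ℕ.+ m)

choose : {A : Set} → Dec A → (A → ℚ) → ℚ
choose (yes a) v = v a
choose (no _)  _ = 0ℚ

choose-nonneg : {A : Set} (d : Dec A) {v : A → ℚ} → (∀ a → 0ℚ ≤ v a) → 0ℚ ≤ choose d v
choose-nonneg (yes a) v≥0 = v≥0 a
choose-nonneg (no _)  _   = ℚ.≤-refl

choose-constant : {A : Set} (d : Dec A) {v : A → ℚ} (a : A) → (∀ b → v b ≡ v a) → choose d v ≡ v a
choose-constant (yes b) a v≡va = v≡va b
choose-constant (no ¬a) a _    = contradiction a ¬a

module _ {p : Fin n → ℕ} (Y : Fin n → Fin n → Fin n → ℚ) (Y-nonneg : ∀ x y z → 0ℚ ≤ Y x y z)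
  (Y-invariant : ∀ σ → PreservesParts p (σ ⟨$⟩ʳ_) → ∀ x y z → Y (σ ⟨$⟩ʳ x) (σ ⟨$⟩ʳ y) (σ ⟨$⟩ʳ z) ≡ Y x y z)
  (M : Block n) (M-constant : Constant p M) where

  private
    Y-supported : ∀ {σ} → SupportedIn (_∈B M) σ → ∀ x y z → Y (σ ⟨$⟩ʳ x) (σ ⟨$⟩ʳ y) (σ ⟨$⟩ʳ z) ≡ Y x y z
    Y-supported {σ} supp = Y-invariant σ (supportedIn-preservesParts {σ = σ} M-constant supp)

    Y-cong : ∀ {x x′ y y′ z z′} → x ≡ x′ → y ≡ y′ → z ≡ z′ → Y x y z ≡ Y x′ y′ z′
    Y-cong refl refl refl = refl

  -- When M is too small to contain a witness, the value picked by choose is irrelevant.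
  invariant⇒similar : Similar Y M
  invariant⇒similar =
    (λ i j → choose D₁ (λ (α , _) → Y i j α)) ,
    (λ i → choose D₂ (λ (α , β , _) → Y i α β)) ,
    choose D₃ (λ (α , β , γ , _) → Y α β γ) ,
    (λ i j → choose-nonneg D₁ (λ (α , _) → Y-nonneg i j α)) ,
    (λ i → choose-nonneg D₂ (λ (α , β , _) → Y-nonneg i α β)) ,
    choose-nonneg D₃ (λ (α , β , γ , _) → Y-nonneg α β γ) ,
    outside-outside , outside , inside
    where
    D₁ : Dec (∃[ α ] α ∈B M)
    D₁ = any? (_∈B? M)
    D₂ : Dec (∃[ α ] ∃[ β ] α ∈B M × β ∈B M × α ≢ β)
    D₂ = any? λ α → any? λ β → α ∈B? M ×-dec β ∈B? M ×-dec ¬? (α ≟ β)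
    D₃ : Dec (∃[ α ] ∃[ β ] ∃[ γ ] α ∈B M × β ∈B M × γ ∈B M × α ≢ β × β ≢ γ × α ≢ γ)
    D₃ = any? λ α → any? λ β → any? λ γ →
      α ∈B? M ×-dec β ∈B? M ×-dec γ ∈B? M ×-dec ¬? (α ≟ β) ×-dec ¬? (β ≟ γ) ×-dec ¬? (α ≟ γ)

    outside-outside : ∀ i j α → ¬ i ∈B M → ¬ j ∈B M → α ∈B M →
      Y i j α ≡ choose D₁ (λ (α , _) → Y i j α)
    outside-outside i j α i∉M j∉M α∈M = sym (choose-constant D₁ (α , α∈M) λ (α′ , α′∈M) →
      case supportedIn-transitive ((α′∈M , α∈M) ∷ []) ([] ∷ []) ([] ∷ []) of λ where
        (σ , supp , σα′≡α ∷ []) → trans (sym (Y-supported {σ} supp i j α′))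
          (Y-cong (supportedIn-fixes {σ = σ} supp i∉M) (supportedIn-fixes {σ = σ} supp j∉M) σα′≡α))

    outside : ∀ i α β → ¬ i ∈B M → α ∈B M → β ∈B M → α ≢ β →
      Y i α β ≡ choose D₂ (λ (α , β , _) → Y i α β)
    outside i α β i∉M α∈M β∈M α≢β = sym (choose-constant D₂ (α , β , α∈M , β∈M , α≢β)
      λ (α′ , β′ , α′∈M , β′∈M , α′≢β′) →
      case supportedIn-transitive ((α′∈M , α∈M) ∷ (β′∈M , β∈M) ∷ [])
             ((α′≢β′ ∷ []) ∷ [] ∷ []) ((α≢β ∷ []) ∷ [] ∷ []) of λ where
        (σ , supp , σα′≡α ∷ σβ′≡β ∷ []) → trans (sym (Y-supported {σ} supp i α′ β′))
          (Y-cong (supportedIn-fixes {σ = σ} supp i∉M) σα′≡α σβ′≡β))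

    inside : ∀ α β γ → α ∈B M → β ∈B M → γ ∈B M → α ≢ β → β ≢ γ → α ≢ γ →
      Y α β γ ≡ choose D₃ (λ (α , β , γ , _) → Y α β γ)
    inside α β γ α∈M β∈M γ∈M α≢β β≢γ α≢γ =
      sym (choose-constant D₃ (α , β , γ , α∈M , β∈M , γ∈M , α≢β , β≢γ , α≢γ)
        λ (α′ , β′ , γ′ , α′∈M , β′∈M , γ′∈M , α′≢β′ , β′≢γ′ , α′≢γ′) →
      case supportedIn-transitive ((α′∈M , α∈M) ∷ (β′∈M , β∈M) ∷ (γ′∈M , γ∈M) ∷ [])
             ((α′≢β′ ∷ α′≢γ′ ∷ []) ∷ (β′≢γ′ ∷ []) ∷ [] ∷ [])
             ((α≢β ∷ α≢γ ∷ []) ∷ (β≢γ ∷ []) ∷ [] ∷ []) of λ where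
        (σ , supp , σα′≡α ∷ σβ′≡β ∷ σγ′≡γ ∷ []) → trans (sym (Y-supported {σ} supp α′ β′ γ′))
          (Y-cong σα′≡α σβ′≡β σγ′≡γ))

mainTheorem13 : (k : ℕ) (p : Fin k → ℕ) → (∀ i → NonZero (p i)) →
    (t : ℕ) (M : Fin t → Block k) →
    (∀ s s′ → s ≢ s′ → Disjoint (M s) (M s′)) →
    (∀ s → Constant p (M s)) →
    (∃[ X ] IsROS p X) ⇔ (∃[ X ] (IsROS p X × (∀ s → Similar X (M s))))
mainTheorem13 k p _ t M _ M-constant = mk⇔
  (λ (X , X-ros) → symmetrise X , symmetrise-isROS X-ros , λ s →
     invariant⇒similar (symmetrise X) (IsROS.nonneg (symmetrise-isROS X-ros))
       (λ σ pres → symmetrise-invariant σ pres X) (M s) (M-constant s))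
  (λ (X , X-ros , _) → X , X-ros)
  where open Stabiliser p
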